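{- Fix $n\in\mathbb{N}$, let $e(n)=2^{2^n}$, let $\mathcal F,\mathcal C$ be as in the context and let $\preccurlyeq$ be a monomial ordering on the monomials in $\mathbb{X}$. If $s\prec\alpha$ for every $\alpha\in\mathcal C$, then $\mathcal C\subseteq\mathcal S_{\mathcal F}$, where $\mathcal S_{\mathcal F}$ is the set of polynomials that are not residual with respect to $\mathcal F$.
   Context: $\mathbb{Z}_2$ is the field with two elements. $\mathbb{X}$ is the finite set of distinct variables $\{s,\ell,c,\bar c,b,\bar b\}\cup\bigcup_{i=0}^n(V_i\cup\bar V_i)$, where $V_i=\{s_i,f_i,q_{1i},\dots,q_{4i},c_{1i},\dots,c_{4i},b_{1i},\dots,b_{4i}\}$ and $\bar V_i=\{\bar s_i,\bar f_i,\bar q_{ki},\bar c_{ki},\bar b_{ki}: k\in\{1,2,3,4\}\}$ (barred variables are new variables). Let $\mathcal P=\bigcup_{m=0}^{n}\mathcal P_m$, where $\mathcal P_0=\{b_{i0}^2c_{i0}f_0+c_{i0}s_0 : i\in\{1,2,3,4\}\}$ and, for $1\le m\le n$, $\mathcal P_m$ consists of $q_{1m}c_{1(m-1)}s_{m-1}+s_m$; $q_{2m}c_{2(m-1)}s_{m-1}+q_{1m}b_{1(m-1)}c_{1(m-1)}f_{m-1}$; $q_{3m}c_{3(m-1)}f_{m-1}+q_{2m}c_{2(m-1)}f_{m-1}$; $q_{3m}b_{1(m-1)}c_{3(m-1)}s_{m-1}+q_{2m}b_{4(m-1)}c_{2(m-1)}s_{m-1}$; $q_{4m}b_{4(m-1)}c_{4(m-1)}f_{m-1}+q_{3m}c_{3(m-1)}s_{m-1}$;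 $q_{4m}c_{4(m-1)}s_{m-1}+f_m$; and $q_{2m}b_{3(m-1)}b_{im}c_{im}f_{m-1}+q_{2m}b_{2(m-1)}c_{im}f_{m-1}$ for $i\in\{1,2,3,4\}$. Let $\bar{\mathcal P}$ be obtained from $\mathcal P$ by replacing every variable $s_i,f_i,q_{ki},c_{ki},b_{ki}$ by $\bar s_i,\bar f_i,\bar q_{ki},\bar c_{ki},\bar b_{ki}$. Let $\mathcal G=\{b_{4n}\ell b+\ell c,\ b_{4n}\ell\bar b+\ell\bar c,\ c_{4n}f_n+\ell,\ \bar c_{4n}\bar f_n+c_{4n}s_n,\ \bar b_{4n}c_{4n}s_n+c_{4n}s_nb,\ \bar b_{4n}c_{4n}s_n+c_{4n}s_n\bar b,\ \bar c_{4n}\bar s_n+s\}$ and $\mathcal F=\mathcal P\cup\bar{\mathcal P}\cup\mathcal G$. Let $\mathcal C=\{\ell\bar c^{m_1}c^{m_2}: m_1,m_2\ge 0,\ m_1+m_2=e(n)\}$. A monomial ordering is a total order on monomials with $1\preccurlyeq t$ and $t_1\preccurlyeq t_2\Rightarrow t_1t_3\preccurlyeq t_2t_3$; it is extended to polynomials by: $g\preccurlyeq f$ iff $g=f$, or the highest monomial of $g$ is below that of $f$, or both have the same highest monomial $t$ and $g-t\preccurlyeq f-t$ (recursively; $0$ is below every nonzero polynomial). A polynomial $f$ is residual w.r.t. $\mathcal F$ if for every $g$ with $f+g\in\langle\mathcal F\rangle$ we have $f\preccurlyeq g$. -}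

module Defs where

open import Data.Nat using (ℕ; zero; suc; _+_; _*_; _^_)
import Data.Nat as ℕ
open import Data.Fin as Fin using (Fin; _↑ˡ_; _↑ʳ_; combine; fromℕ; inject₁)
open import Data.Bool using (Bool; true; false; if_then_else_; _xor_)
open import Data.Vec using (Vec; tabulate; zipWith; replicate)
open import Data.Vec.Properties using (≡-dec)
open import Data.List as List using (List; []; _∷_; _++_; concatMap; foldr)
open import Data.Product using (Σ; _×_; _,_; ∃)
open import Relation.Nullary using (¬_; does; Dec)
open import Relation.Nullary.Decidable using (map′)
open import Relation.Binary using (IsTotalOrder)
open import Relation.Binary.PropositionalEquality using (_≡_; _≢_; cong)

-- Layout: 0..5 = s, ℓ, c, c̄, b, b̄;  then the unbarred blocks V_0..V_n,
-- then the barred blocks V̄_0..V̄_n.  Inside a block (14 variables):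
-- 0 = s_i, 1 = f_i, 2..5 = q_{1i}..q_{4i}, 6..9 = c_{1i}..c_{4i},
-- 10..13 = b_{1i}..b_{4i}.

nvars : ℕ → ℕ
nvars n = 6 + (suc n * 14 + suc n * 14)

Var : ℕ → Set
Var n = Fin (nvars n)

module Vars (n : ℕ) where
  base : Fin 6 → Var n
  base k = k ↑ˡ (suc n * 14 + suc n * 14)

  vs vℓ vc vc̄ vb vb̄ : Var n
  vs  = base Fin.zero
  vℓ  = base (Fin.suc Fin.zero)
  vc  = base (Fin.suc (Fin.suc Fin.zero))
  vc̄  = base (Fin.suc (Fin.suc (Fin.suc Fin.zero)))
  vb  = base (Fin.suc (Fin.suc (Fin.suc (Fin.suc Fin.zero))))
  vb̄  = base (Fin.suc (Fin.suc (Fin.suc (Fin.suc (Fin.suc Fin.zero)))))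

  -- bar = false : variable of V_i ; bar = true : the barred copy in V̄_i
  blk : Bool → Fin (suc n) → Fin 14 → Var n
  blk false i j = 6 ↑ʳ (combine i j ↑ˡ (suc n * 14))
  blk true  i j = 6 ↑ʳ ((suc n * 14) ↑ʳ combine i j)

  -- k : Fin 4 stands for the index k+1 ∈ {1,2,3,4}
  sV fV : Bool → Fin (suc n) → Var n
  sV bar i = blk bar i Fin.zero
  fV bar i = blk bar i (Fin.suc Fin.zero)

  qV cV bV : Bool → Fin 4 → Fin (suc n) → Var n
  qV bar k i = blk bar i (2 ↑ʳ (k ↑ˡ 8))
  cV bar k i = blk bar i (6 ↑ʳ (k ↑ˡ 4))
  bV bar k i = blk bar i (10 ↑ʳ k)

k₁ k₂ k₃ k₄ : Fin 4
k₁ = Fin.zero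
k₂ = Fin.suc Fin.zero
k₃ = Fin.suc (Fin.suc Fin.zero)
k₄ = Fin.suc (Fin.suc (Fin.suc Fin.zero))

record Monomial (n : ℕ) : Set where
  constructor mkM
  field exps : Vec ℕ (nvars n)

open Monomial public

one : ∀ {n} → Monomial n
one = mkM (replicate _ 0)

_·_ : ∀ {n} → Monomial n → Monomial n → Monomial n
t · u = mkM (zipWith _+_ (exps t) (exps u))

unitM : ∀ {n} → Var n → Monomial n
unitM x = mkM (tabulate λ j → if does (j Fin.≟ x) then 1 else 0)

mono : ∀ {n} → List (Var n) → Monomial n
mono = foldr (λ x m → unitM x · m) one

_≟M_ : ∀ {n} (t u : Monomial n) → Dec (t ≡ u)
mkM v ≟M mkM w = map′ (cong mkM) (cong exps) (≡-dec ℕ._≟_ v w)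

-- Polynomials over ℤ₂: a list of monomials; the coefficient of a monomial
-- is the parity of its number of occurrences.  Sum = concatenation.

Poly : ℕ → Set
Poly n = List (Monomial n)

coeff : ∀ {n} → Poly n → Monomial n → Bool
coeff []      m = false
coeff (t ∷ p) m = does (t ≟M m) xor coeff p m

_≈_ : ∀ {n} → Poly n → Poly n → Set
p ≈ q = ∀ m → coeff p m ≡ coeff q m

IsZero : ∀ {n} → Poly n → Set
IsZero p = ∀ m → coeff p m ≡ false

_⊕_ : ∀ {n} → Poly n → Poly n → Poly n
_⊕_ = _++_

_⊗_ : ∀ {n} → Poly n → Poly n → Poly n
p ⊗ q = concatMap (λ t → List.map (t ·_) q) p

bin : ∀ {n} → List (Var n) → List (Var n) → Poly n
bin xs ys = mono xs ∷ mono ys ∷ []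

module Gens (n : ℕ) where
  open Vars n

  -- 𝓟 (bar = false) and 𝓟̄ (bar = true).  For i : Fin n, the index
  -- m = suc i ranges over 1..n and m-1 = inject₁ i.
  data InP (bar : Bool) : Poly n → Set where
    p0 : (k : Fin 4) →
      InP bar (bin (bV bar k Fin.zero ∷ bV bar k Fin.zero ∷ cV bar k Fin.zero ∷ fV bar Fin.zero ∷ [])
                   (cV bar k Fin.zero ∷ sV bar Fin.zero ∷ []))
    p1 : (i : Fin n) → let a = inject₁ i ; m = Fin.suc i in
      InP bar (bin (qV bar k₁ m ∷ cV bar k₁ a ∷ sV bar a ∷ [])
                   (sV bar m ∷ []))
    p2 : (i : Fin n) → let a = inject₁ i ; m = Fin.suc i in
      InP bar (bin (qV bar k₂ m ∷ cV bar k₂ a ∷ sV bar a ∷ [])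
                   (qV bar k₁ m ∷ bV bar k₁ a ∷ cV bar k₁ a ∷ fV bar a ∷ []))
    p3 : (i : Fin n) → let a = inject₁ i ; m = Fin.suc i in
      InP bar (bin (qV bar k₃ m ∷ cV bar k₃ a ∷ fV bar a ∷ [])
                   (qV bar k₂ m ∷ cV bar k₂ a ∷ fV bar a ∷ []))
    p4 : (i : Fin n) → let a = inject₁ i ; m = Fin.suc i in
      InP bar (bin (qV bar k₃ m ∷ bV bar k₁ a ∷ cV bar k₃ a ∷ sV bar a ∷ [])
                   (qV bar k₂ m ∷ bV bar k₄ a ∷ cV bar k₂ a ∷ sV bar a ∷ []))
    p5 : (i : Fin n) → let a = inject₁ i ; m = Fin.suc i in
      InP bar (bin (qV bar k₄ m ∷ bV bar k₄ a ∷ cV bar k₄ a ∷ fV bar a ∷ [])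
                   (qV bar k₃ m ∷ cV bar k₃ a ∷ sV bar a ∷ []))
    p6 : (i : Fin n) → let a = inject₁ i ; m = Fin.suc i in
      InP bar (bin (qV bar k₄ m ∷ cV bar k₄ a ∷ sV bar a ∷ [])
                   (fV bar m ∷ []))
    p7 : (i : Fin n) (k : Fin 4) → let a = inject₁ i ; m = Fin.suc i in
      InP bar (bin (qV bar k₂ m ∷ bV bar k₃ a ∷ bV bar k m ∷ cV bar k m ∷ fV bar a ∷ [])
                   (qV bar k₂ m ∷ bV bar k₂ a ∷ cV bar k m ∷ fV bar a ∷ []))

  N : Fin (suc n)
  N = fromℕ n

  data InF : Poly n → Set where
    inP  : ∀ {p} → InP false p → InF p
    inP̄  : ∀ {p} → InP true p → InF p
    g1 : InF (bin (bV false k₄ N ∷ vℓ ∷ vb ∷ []) (vℓ ∷ vc ∷ []))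
    g2 : InF (bin (bV false k₄ N ∷ vℓ ∷ vb̄ ∷ []) (vℓ ∷ vc̄ ∷ []))
    g3 : InF (bin (cV false k₄ N ∷ fV false N ∷ []) (vℓ ∷ []))
    g4 : InF (bin (cV true k₄ N ∷ fV true N ∷ []) (cV false k₄ N ∷ sV false N ∷ []))
    g5 : InF (bin (bV true k₄ N ∷ cV false k₄ N ∷ sV false N ∷ [])
                  (cV false k₄ N ∷ sV false N ∷ vb ∷ []))
    g6 : InF (bin (bV true k₄ N ∷ cV false k₄ N ∷ sV false N ∷ [])
                  (cV false k₄ N ∷ sV false N ∷ vb̄ ∷ []))
    g7 : InF (bin (cV true k₄ N ∷ sV true N ∷ []) (vs ∷ []))

  data Comb : Poly n → Set where
    c[] : Comb []
    c∷  : ∀ {p g} (h : Poly n) → InF g → Comb p → Comb ((h ⊗ g) ⊕ p)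

  InIdeal : Poly n → Set
  InIdeal f = ∃ λ p → Comb p × (f ≈ p)

  αC : ℕ → ℕ → Monomial n
  αC m₁ m₂ = mono (vℓ ∷ (List.replicate m₁ vc̄ ++ List.replicate m₂ vc))

e : ℕ → ℕ
e n = 2 ^ (2 ^ n)

record MonomialOrder (n : ℕ) : Set₁ where
  field
    _≼_          : Monomial n → Monomial n → Set
    isTotalOrder : IsTotalOrder _≡_ _≼_
    one-least    : ∀ t → one ≼ t
    compatible   : ∀ t₁ t₂ t₃ → t₁ ≼ t₂ → (t₁ · t₃) ≼ (t₂ · t₃)

  _≺_ : Monomial n → Monomial n → Set
  t ≺ u = (t ≼ u) × (t ≢ u)

  IsLead : Poly n → Monomial n → Set
  IsLead p t = (coeff p t ≡ true) × (∀ u → coeff p u ≡ true → u ≼ t)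

  -- the extension of ≼ to polynomials (least relation closed under the
  -- recursive clauses of the definition; the recursion is well founded)
  data _⊑_ : Poly n → Poly n → Set where
    ⊑-eq   : ∀ {g f} → g ≈ f → g ⊑ f
    ⊑-zero : ∀ {g f} → IsZero g → ¬ IsZero f → g ⊑ f
    ⊑-lt   : ∀ {g f t u} → IsLead g t → IsLead f u → t ≺ u → g ⊑ f
    ⊑-same : ∀ {g f t} → IsLead g t → IsLead f t →
             (g ⊕ (t ∷ [])) ⊑ (f ⊕ (t ∷ [])) → g ⊑ f

  Residual : Poly n → Set
  Residual f = ∀ g → Gens.InIdeal n (f ⊕ g) → f ⊑ g

  InS : Poly n → Set
  InS f = ¬ Residual f

{-# OPTIONS --safe #-}

-- Every element of 𝓕 is a binomial a + b, so two monomials connected by a chain of moves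
-- w·a ↔ w·b differ by an element of ⟨𝓕⟩.  The rules of 𝓟 (and of 𝓟̄) form a Mayr–Meyer
-- counter: by induction on m, s_m c_{km} is connected to f_m c_{km} b_{km}^{e(m)}, the
-- exponent being squared from one level to the next.  The rules of 𝓖 use the level-n
-- counters of 𝓟 and 𝓟̄ to connect ℓ c̄^{m₁} c^{m₂} with s whenever m₁ + m₂ = e(n), so
-- α + s ∈ ⟨𝓕⟩ for every α ∈ 𝓒; as s ≺ α, the polynomial s lies strictly below α and α is
-- not residual.

module Submission where

open import Level using (_⊔_; 0ℓ)
open import Algebra.Bundles using (CommutativeMonoid)
open import Algebra.Structures using (IsCommutativeMonoid)
import Algebra.Properties.CommutativeMonoid.Mult as Mult
import Algebra.Properties.CommutativeSemigroup as CommutativeSemigroupProperties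
import Algebra.Solver.CommutativeMonoid.Normal as Normal
open import Data.Bool using (Bool; true; false; _xor_)
open import Data.Bool.Properties using (xor-assoc; xor-comm; xor-same; xor-identityʳ)
open import Data.Fin using (Fin; zero; suc; toℕ; inject₁; #_)
open import Data.Fin.Induction using (<-weakInduction)
open import Data.Fin.Properties using (toℕ-inject₁; toℕ-fromℕ)
open import Data.List as List using (List; []; _∷_)
open import Data.List.Properties using (++-assoc)
open import Data.Nat using (ℕ; zero; suc; _+_; _*_; _∸_; pred) renaming (_^_ to _^ℕ_)
open import Data.Nat.Properties
  using (+-assoc; +-comm; +-identityˡ; +-identityʳ; *-comm; ^-distribˡ-+-*; suc-pred; m^n≢0)
open import Data.Product using (_×_; _,_)
open import Data.Vec using (Vec; []; _∷_; zipWith)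
open import Data.Vec.Properties
  using (zipWith-assoc; zipWith-comm; zipWith-identityˡ; zipWith-identityʳ)
open import Relation.Binary using (Rel; Setoid; IsEquivalence; IsTotalOrder)
open import Relation.Binary.PropositionalEquality as ≡ using (_≡_; cong; cong₂; subst)
import Relation.Binary.Reasoning.Setoid as SetoidReasoning
open import Relation.Nullary using (¬_; Dec; does; proof)
open import Relation.Nullary.Reflects using (Reflects; invert)
open import Relation.Nullary.Decidable using (True; toWitness; _×-dec_; dec-true)

open import Defs renaming (_≈_ to _≈ₚ_)

module _ {n : ℕ} where

  ·-assoc : (t u v : Monomial n) → (t · u) · v ≡ t · (u · v)
  ·-assoc (mkM a) (mkM b) (mkM c) = cong mkM (zipWith-assoc +-assoc a b c)

  ·-comm : (t u : Monomial n) → t · u ≡ u · t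
  ·-comm (mkM a) (mkM b) = cong mkM (zipWith-comm +-comm a b)

  ·-identityˡ : (t : Monomial n) → one · t ≡ t
  ·-identityˡ (mkM a) = cong mkM (zipWith-identityˡ +-identityˡ a)

  ·-identityʳ : (t : Monomial n) → t · one ≡ t
  ·-identityʳ (mkM a) = cong mkM (zipWith-identityʳ +-identityʳ a)

·-isCommutativeMonoid : (n : ℕ) → IsCommutativeMonoid {A = Monomial n} _≡_ _·_ one
·-isCommutativeMonoid n = record
  { isMonoid = record
    { isSemigroup = record
      { isMagma = record { isEquivalence = ≡.isEquivalence ; ∙-cong = cong₂ _·_ }
      ; assoc = ·-assoc
      }
    ; identity = ·-identityˡ , ·-identityʳ
    }
  ; comm = ·-comm
  }

·-commutativeMonoid : ℕ → CommutativeMonoid 0ℓ 0ℓ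
·-commutativeMonoid n = record { isCommutativeMonoid = ·-isCommutativeMonoid n }

-- Congruences and powers in commutative monoids

module CongruenceClosure {c ℓ r} (M : CommutativeMonoid c ℓ)
  (R : Rel (CommutativeMonoid.Carrier M) r) where

  open CommutativeMonoid M

  infix 4 _~_
  data _~_ : Rel Carrier (c ⊔ ℓ ⊔ r) where
    ≈⇒~     : ∀ {x y} → x ≈ y → x ~ y
    rule    : ∀ {a b} → R a b → ∀ w → w ∙ a ~ w ∙ b
    ~-sym   : ∀ {x y} → x ~ y → y ~ x
    ~-trans : ∀ {x y z} → x ~ y → y ~ z → x ~ z

  ~-isEquivalence : IsEquivalence _~_
  ~-isEquivalence = record
    { refl = ≈⇒~ refl ; sym = ~-sym ; trans = ~-trans }

  ~-congˡ : ∀ {x y} w → x ~ y → w ∙ x ~ w ∙ y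
  ~-congˡ w (≈⇒~ x≈y)     = ≈⇒~ (∙-congˡ x≈y)
  ~-congˡ w (rule g v)     =
    ~-trans (≈⇒~ (sym (assoc w v _))) (~-trans (rule g (w ∙ v)) (≈⇒~ (assoc w v _)))
  ~-congˡ w (~-sym x~y)    = ~-sym (~-congˡ w x~y)
  ~-congˡ w (~-trans x~y y~z) = ~-trans (~-congˡ w x~y) (~-congˡ w y~z)

  ~-cong : ∀ {x y u v} → x ~ y → u ~ v → x ∙ u ~ y ∙ v
  ~-cong {x} {y} {u} {v} x~y u~v = ~-trans (~-congˡ x u~v)
    (~-trans (≈⇒~ (comm x v)) (~-trans (~-congˡ v x~y) (≈⇒~ (comm v y))))

  rule-unit : ∀ {a b} → R a b → a ~ b
  rule-unit {a} {b} g =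
    ~-trans (≈⇒~ (sym (identityˡ a))) (~-trans (rule g ε) (≈⇒~ (identityˡ b)))

  quotient : CommutativeMonoid c (c ⊔ ℓ ⊔ r)
  quotient = record
    { _≈_ = _~_
    ; isCommutativeMonoid = record
      { isMonoid = record
        { isSemigroup = record
          { isMagma = record { isEquivalence = ~-isEquivalence ; ∙-cong = ~-cong }
          ; assoc = λ x y z → ≈⇒~ (assoc x y z)
          }
        ; identity = (λ x → ≈⇒~ (identityˡ x)) , (λ x → ≈⇒~ (identityʳ x))
        }
      ; comm = λ x y → ≈⇒~ (comm x y)
      }
    }

module Powers {c ℓ} (M : CommutativeMonoid c ℓ) where

  open CommutativeMonoid M
  open Mult M using (×-distrib-+; ×-homo-+; ×-assocˡ; ×-congˡ) renaming (_×_ to _×ᴹ_)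
  open CommutativeSemigroupProperties commutativeSemigroup using (x∙yz≈y∙xz)
  open SetoidReasoning setoid

  infixr 25 _^_
  _^_ : Carrier → ℕ → Carrier
  x ^ j = j ×ᴹ x

  catalysed-^ : ∀ {a x y} → a ∙ x ≈ a ∙ y → ∀ j → a ∙ x ^ j ≈ a ∙ y ^ j
  catalysed-^ ax≈ay zero = refl
  catalysed-^ {a} {x} {y} ax≈ay (suc j) = begin
    a ∙ (x ∙ x ^ j)  ≈⟨ assoc a x _ ⟨
    (a ∙ x) ∙ x ^ j  ≈⟨ ∙-congʳ ax≈ay ⟩
    (a ∙ y) ∙ x ^ j  ≈⟨ assoc a y _ ⟩
    a ∙ (y ∙ x ^ j)  ≈⟨ x∙yz≈y∙xz a y _ ⟩
    y ∙ (a ∙ x ^ j)  ≈⟨ ∙-congˡ (catalysed-^ ax≈ay j) ⟩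
    y ∙ (a ∙ y ^ j)  ≈⟨ x∙yz≈y∙xz y a _ ⟩
    a ∙ (y ∙ y ^ j)  ∎

  catalysed-^-∙ : ∀ {a x y z} → a ∙ x ≈ a ∙ (y ∙ z) → ∀ j →
                  a ∙ x ^ j ≈ a ∙ (y ^ j ∙ z ^ j)
  catalysed-^-∙ {y = y} {z} h j = trans (catalysed-^ h j) (∙-congˡ (×-distrib-+ y z j))

  ^-distribˡ-+-∙ : ∀ x m n → x ^ (m + n) ≈ x ^ m ∙ x ^ n
  ^-distribˡ-+-∙ = ×-homo-+

  ^-*-assoc : ∀ x m n → (x ^ m) ^ n ≈ x ^ (m * n)
  ^-*-assoc x m n = trans (×-assocˡ x n m) (×-congˡ (*-comm n m))

-- Rewriting modulo associativity and commutativity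

module RewritingModuloAC {c ℓ} (M : CommutativeMonoid c ℓ) {k : ℕ}
  (ρ : Vec (CommutativeMonoid.Carrier M) k) where

  open CommutativeMonoid M
  private module N = Normal M
  open N public using (Expr; var; id) renaming (_⊕_ to _⊙_)
  open N using (⟦_⟧; Normal; normalise; ⟦_⟧⇓; _•_; _≟_; correct; comp-correct)
  open SetoidReasoning setoid

  infix 4 _≋_
  record _≋_ (e₁ e₂ : Expr k) : Set ℓ where
    constructor ⟨_⟩
    field ≈⟦⟧ : ⟦ e₁ ⟧ ρ ≈ ⟦ e₂ ⟧ ρ
  open _≋_ public

  ≋-setoid : Setoid 0ℓ ℓ
  ≋-setoid = record
    { Carrier = Expr k
    ; _≈_ = _≋_
    ; isEquivalence = record
      { refl = ⟨ refl ⟩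
      ; sym = λ e₁≋e₂ → ⟨ sym (≈⟦⟧ e₁≋e₂) ⟩
      ; trans = λ e₁≋e₂ e₂≋e₃ → ⟨ trans (≈⟦⟧ e₁≋e₂) (≈⟦⟧ e₂≋e₃) ⟩
      }
    }

  ≋-sym : ∀ {e₁ e₂} → e₁ ≋ e₂ → e₂ ≋ e₁
  ≋-sym = Setoid.sym ≋-setoid

  factor-⟦⟧ : ∀ e l w → normalise e ≡ normalise l • w → ⟦ e ⟧ ρ ≈ ⟦ l ⟧ ρ ∙ ⟦ w ⟧⇓ ρ
  factor-⟦⟧ e l w e≡l•w = begin
    ⟦ e ⟧ ρ                        ≈⟨ correct e ρ ⟨
    ⟦ normalise e ⟧⇓ ρ             ≡⟨ cong (λ v → ⟦ v ⟧⇓ ρ) e≡l•w ⟩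
    ⟦ normalise l • w ⟧⇓ ρ         ≈⟨ comp-correct (normalise l) w ρ ⟩
    ⟦ normalise l ⟧⇓ ρ ∙ ⟦ w ⟧⇓ ρ  ≈⟨ ∙-congʳ (correct l ρ) ⟩
    ⟦ l ⟧ ρ ∙ ⟦ w ⟧⇓ ρ             ∎

  context : Expr k → Expr k → Normal k
  context e l = zipWith _∸_ (normalise e) (normalise l)

  -- l ≈ r rewrites e₁ to e₂ when, as bags of atoms, e₁ = l·w and e₂ = r·w; the only
  -- candidate for w is the bag difference e₁ − l.
  Rewrites : (l r e₁ e₂ : Expr k) → Set
  Rewrites l r e₁ e₂ =
    normalise e₁ ≡ normalise l • context e₁ l × normalise e₂ ≡ normalise r • context e₁ l

  rewrites? : ∀ l r e₁ e₂ → Dec (Rewrites l r e₁ e₂)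
  rewrites? l r e₁ e₂ = (normalise e₁ ≟ _) ×-dec (normalise e₂ ≟ _)

  rewrite-sound : ∀ {l r e₁ e₂} → l ≋ r → Rewrites l r e₁ e₂ → e₁ ≋ e₂
  rewrite-sound {l} {r} {e₁} {e₂} ⟨ l≈r ⟩ (e₁≡l•w , e₂≡r•w) = ⟨ begin
    ⟦ e₁ ⟧ ρ            ≈⟨ factor-⟦⟧ e₁ l w e₁≡l•w ⟩
    ⟦ l ⟧ ρ ∙ ⟦ w ⟧⇓ ρ  ≈⟨ ∙-congʳ l≈r ⟩
    ⟦ r ⟧ ρ ∙ ⟦ w ⟧⇓ ρ  ≈⟨ factor-⟦⟧ e₂ r w e₂≡r•w ⟨
    ⟦ e₂ ⟧ ρ            ∎ ⟩
    where
    w : Normal k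
    w = context e₁ l

  by : ∀ {l r e₁ e₂} → l ≋ r → {True (rewrites? l r e₁ e₂)} → e₁ ≋ e₂
  by l≋r {ok} = rewrite-sound l≋r (toWitness ok)

-- Binomial moves and the ideal ⟨𝓕⟩

module _ {n : ℕ} where

  open Gens n

  coeff-⊕ : ∀ (p q : Poly n) m → coeff (p ⊕ q) m ≡ coeff p m xor coeff q m
  coeff-⊕ []      q m = ≡.refl
  coeff-⊕ (t ∷ p) q m =
    ≡.trans (cong (does (t ≟M m) xor_) (coeff-⊕ p q m))
            (≡.sym (xor-assoc (does (t ≟M m)) (coeff p m) (coeff q m)))

  Comb-⊕ : ∀ {p q} → Comb p → Comb q → Comb (p ⊕ q)
  Comb-⊕ c[]                       cq = cq
  Comb-⊕ {q = q} (c∷ {p} {g} h g∈𝓕 cp) cq =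
    subst Comb (≡.sym (++-assoc (h ⊗ g) p q)) (c∷ h g∈𝓕 (Comb-⊕ cp cq))

  InIdeal-⊕ : ∀ {f g} → InIdeal f → InIdeal g → InIdeal (f ⊕ g)
  InIdeal-⊕ {f} {g} (p , cp , f≈p) (q , cq , g≈q) = p ⊕ q , Comb-⊕ cp cq , λ m → begin
    coeff (f ⊕ g) m          ≡⟨ coeff-⊕ f g m ⟩
    coeff f m xor coeff g m  ≡⟨ cong₂ _xor_ (f≈p m) (g≈q m) ⟩
    coeff p m xor coeff q m  ≡⟨ coeff-⊕ p q m ⟨
    coeff (p ⊕ q) m          ∎
    where open ≡.≡-Reasoning

  InIdeal-resp-≈ₚ : ∀ {f g} → f ≈ₚ g → InIdeal f → InIdeal g
  InIdeal-resp-≈ₚ f≈g (p , cp , f≈p) = p , cp , λ m → ≡.trans (≡.sym (f≈g m)) (f≈p m)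

  coeff-binomial : ∀ (t u m : Monomial n) →
                   coeff (t ∷ u ∷ []) m ≡ does (t ≟M m) xor does (u ≟M m)
  coeff-binomial t u m = cong (does (t ≟M m) xor_) (xor-identityʳ _)

  binomial-comm : ∀ (t u : Monomial n) → (t ∷ u ∷ []) ≈ₚ (u ∷ t ∷ [])
  binomial-comm t u m = begin
    coeff (t ∷ u ∷ []) m                ≡⟨ coeff-binomial t u m ⟩
    does (t ≟M m) xor does (u ≟M m)     ≡⟨ xor-comm (does (t ≟M m)) (does (u ≟M m)) ⟩
    does (u ≟M m) xor does (t ≟M m)     ≡⟨ coeff-binomial u t m ⟨
    coeff (u ∷ t ∷ []) m                ∎
    where open ≡.≡-Reasoning

  binomial-trans : ∀ (t u v : Monomial n) → ((t ∷ u ∷ []) ⊕ (u ∷ v ∷ [])) ≈ₚ (t ∷ v ∷ [])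
  binomial-trans t u v m = begin
    coeff ((t ∷ u ∷ []) ⊕ (u ∷ v ∷ [])) m  ≡⟨ coeff-⊕ (t ∷ u ∷ []) (u ∷ v ∷ []) m ⟩
    coeff (t ∷ u ∷ []) m xor coeff (u ∷ v ∷ []) m
      ≡⟨ cong₂ _xor_ (coeff-binomial t u m) (coeff-binomial u v m) ⟩
    (x xor y) xor (y xor z)                ≡⟨ xor-assoc x y _ ⟩
    x xor (y xor (y xor z))                ≡⟨ cong (x xor_) (xor-assoc y y z) ⟨
    x xor ((y xor y) xor z)                ≡⟨ cong (λ b → x xor (b xor z)) (xor-same y) ⟩
    x xor z                                ≡⟨ coeff-binomial t v m ⟨
    coeff (t ∷ v ∷ []) m                   ∎
    where
    open ≡.≡-Reasoning
    x y z : Bool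
    x = does (t ≟M m); y = does (u ≟M m); z = does (v ≟M m)

module Moves (n : ℕ) =
  CongruenceClosure (·-commutativeMonoid n) (λ a b → Gens.InF n (a ∷ b ∷ []))

module _ {n : ℕ} where

  open Gens n
  open Moves n

  ~⇒InIdeal : ∀ {t u} → t ~ u → InIdeal (t ∷ u ∷ [])
  ~⇒InIdeal {t} (≈⇒~ ≡.refl) =
    [] , c[] , λ m → ≡.trans (coeff-binomial t t m) (xor-same (does (t ≟M m)))
  ~⇒InIdeal (rule g w) = _ , c∷ (w ∷ []) g c[] , λ m → ≡.refl
  ~⇒InIdeal {t} {u} (~-sym u~t) =
    InIdeal-resp-≈ₚ {f = u ∷ t ∷ []} {g = t ∷ u ∷ []} (binomial-comm u t) (~⇒InIdeal u~t)
  ~⇒InIdeal {t} {v} (~-trans {y = u} t~u u~v) =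
    InIdeal-resp-≈ₚ {f = (t ∷ u ∷ []) ⊕ (u ∷ v ∷ [])} {g = t ∷ v ∷ []} (binomial-trans t u v)
      (InIdeal-⊕ {f = t ∷ u ∷ []} {g = u ∷ v ∷ []} (~⇒InIdeal t~u) (~⇒InIdeal u~v))

module _ {n : ℕ} where

  singleton-coeff : ∀ (t : Monomial n) → coeff (t ∷ []) t ≡ true
  singleton-coeff t = ≡.trans (xor-identityʳ _) (dec-true (t ≟M t) ≡.refl)

  singleton-support : ∀ {t m : Monomial n} → coeff (t ∷ []) m ≡ true → t ≡ m
  singleton-support {t} {m} t∈ =
    invert (subst (Reflects _) (≡.trans (≡.sym (xor-identityʳ _)) t∈) (proof (t ≟M m)))

  module _ (O : MonomialOrder n) where

    open MonomialOrder O
    open IsTotalOrder isTotalOrder using (antisym)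

    ≺⇒⋢ : ∀ {t u} → t ≺ u → ¬ ((u ∷ []) ⊑ (t ∷ []))
    ≺⇒⋢ {t} {u} (t≼u , t≢u) (⊑-eq u≈t) =
      t≢u (singleton-support (≡.trans (≡.sym (u≈t u)) (singleton-coeff u)))
    ≺⇒⋢ {t} {u} (t≼u , t≢u) (⊑-zero u≈0 _)
      with () ← ≡.trans (≡.sym (singleton-coeff u)) (u≈0 u)
    ≺⇒⋢ {t} {u} (t≼u , t≢u) (⊑-lt {t = u′} {u = t′} (u∈ , _) (t∈ , _) (u′≼t′ , _))
      with ≡.refl ← singleton-support {u} {u′} u∈ | ≡.refl ← singleton-support {t} {t′} t∈ =
      t≢u (antisym t≼u u′≼t′)
    ≺⇒⋢ {t} {u} (t≼u , t≢u) (⊑-same {t = v} (u∈ , _) (t∈ , _) _)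
      with ≡.refl ← singleton-support {u} {v} u∈ | ≡.refl ← singleton-support {t} {v} t∈ =
      t≢u ≡.refl

module _ {n : ℕ} where

  open Powers (Moves.quotient n) public using (_^_)

  mono-++ : (xs ys : List (Var n)) → mono {n} (xs List.++ ys) ≡ mono xs · mono ys
  mono-++ []       ys = ≡.sym (·-identityˡ (mono ys))
  mono-++ (x ∷ xs) ys = ≡.trans (cong (unitM x ·_) (mono-++ xs ys))
                                (≡.sym (·-assoc (unitM x) (mono xs) (mono ys)))

  mono-replicate : ∀ j (x : Var n) → mono {n} (List.replicate j x) ≡ unitM x ^ j
  mono-replicate zero    x = ≡.refl
  mono-replicate (suc j) x = cong (unitM x ·_) (mono-replicate j x)

e-suc : ∀ t → e (suc t) ≡ e t * e t
e-suc t = ≡.trans (cong (2 ^ℕ_) (cong (2 ^ℕ t +_) (+-identityʳ (2 ^ℕ t))))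
                  (^-distribˡ-+-* 2 (2 ^ℕ t) (2 ^ℕ t))

suc-pred-e : ∀ t → suc (pred (e t)) ≡ e t
suc-pred-e t = suc-pred (e t) {{m^n≢0 2 (2 ^ℕ t)}}

InP⇒InF : ∀ {n} bar {p} → Gens.InP n bar p → Gens.InF n p
InP⇒InF false = Gens.inP
InP⇒InF true  = Gens.inP̄

-- The Mayr–Meyer counter and the reduction of 𝓒 to s

module Counter (n : ℕ) (bar : Bool) where

  open Gens n
  open Vars n
  open Moves n
  open Powers quotient using (catalysed-^-∙; ^-*-assoc)

  S F : Fin (suc n) → Monomial n
  S i = unitM (sV bar i)
  F i = unitM (fV bar i)

  C B Q : Fin 4 → Fin (suc n) → Monomial n
  C k i = unitM (cV bar k i)
  B k i = unitM (bV bar k i)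
  Q k i = unitM (qV bar k i)

  move : ∀ {a b} → InP bar (a ∷ b ∷ []) → a ~ b
  move g = rule-unit (InP⇒InF bar g)

  CounterAt : Fin (suc n) → Set
  CounterAt i = ∀ k → S i · C k i ~ F i · (C k i · B k i ^ e (toℕ i))

  counter-zero : CounterAt zero
  counter-zero k = ≈⟦⟧ s₀c≋f₀cbb
    where
    open RewritingModuloAC quotient (S zero ∷ F zero ∷ C k zero ∷ B k zero ∷ [])
    s f c b : Expr 4
    s = var (# 0); f = var (# 1); c = var (# 2); b = var (# 3)
    p₀ : b ⊙ b ⊙ c ⊙ f ⊙ id ≋ c ⊙ s ⊙ id
    p₀ = ⟨ move (p0 k) ⟩
    s₀c≋f₀cbb : s ⊙ c ≋ f ⊙ c ⊙ b ⊙ b ⊙ id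
    s₀c≋f₀cbb = by (≋-sym p₀)

  -- The exponent is written suc E′ because the move p₂ consumes one b₁.
  module Step (i : Fin n) (k : Fin 4) (E′ : ℕ)
    (ih : ∀ k′ → S (inject₁ i) · C k′ (inject₁ i)
                   ~ F (inject₁ i) · (C k′ (inject₁ i) · B k′ (inject₁ i) ^ suc E′)) where

    E : ℕ
    E = suc E′
    a m : Fin (suc n)
    a = inject₁ i
    m = suc i

    open RewritingModuloAC quotient
      ( S a ∷ F a ∷ C k₁ a ∷ C k₂ a ∷ C k₃ a ∷ C k₄ a ∷ B k₁ a ∷ B k₂ a ∷ B k₃ a ∷ B k₄ a
      ∷ Q k₁ m ∷ Q k₂ m ∷ Q k₃ m ∷ Q k₄ m ∷ S m ∷ F m ∷ C k m ∷ B k m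
      ∷ B k₁ a ^ E′ ∷ B k₂ a ^ E ∷ B k₃ a ^ E ∷ B k₄ a ^ E′ ∷ B k m ^ E ∷ (B k m ^ E) ^ E′ ∷ [])
    open SetoidReasoning ≋-setoid

    sₐ fₐ c₁ c₂ c₃ c₄ b₁ b₂ b₃ b₄ q₁ q₂ q₃ q₄ sₘ fₘ c b b₁^E′ b₂^E b₃^E b₄^E′ b^E b^EE′ : Expr 24
    sₐ = var (# 0);  fₐ = var (# 1)
    c₁ = var (# 2);  c₂ = var (# 3);  c₃ = var (# 4);  c₄ = var (# 5)
    b₁ = var (# 6);  b₂ = var (# 7);  b₃ = var (# 8);  b₄ = var (# 9)
    q₁ = var (# 10); q₂ = var (# 11); q₃ = var (# 12); q₄ = var (# 13)
    sₘ = var (# 14); fₘ = var (# 15); c = var (# 16);  b = var (# 17)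
    b₁^E′ = var (# 18); b₂^E = var (# 19); b₃^E = var (# 20); b₄^E′ = var (# 21)
    b^E = var (# 22); b^EE′ = var (# 23)

    p₁ : q₁ ⊙ c₁ ⊙ sₐ ⊙ id ≋ sₘ ⊙ id
    p₁ = ⟨ move (p1 i) ⟩
    p₂ : q₂ ⊙ c₂ ⊙ sₐ ⊙ id ≋ q₁ ⊙ b₁ ⊙ c₁ ⊙ fₐ ⊙ id
    p₂ = ⟨ move (p2 i) ⟩
    p₃ : q₃ ⊙ c₃ ⊙ fₐ ⊙ id ≋ q₂ ⊙ c₂ ⊙ fₐ ⊙ id
    p₃ = ⟨ move (p3 i) ⟩
    p₄ : q₃ ⊙ b₁ ⊙ c₃ ⊙ sₐ ⊙ id ≋ q₂ ⊙ b₄ ⊙ c₂ ⊙ sₐ ⊙ id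
    p₄ = ⟨ move (p4 i) ⟩
    p₅ : q₄ ⊙ b₄ ⊙ c₄ ⊙ fₐ ⊙ id ≋ q₃ ⊙ c₃ ⊙ sₐ ⊙ id
    p₅ = ⟨ move (p5 i) ⟩
    p₆ : q₄ ⊙ c₄ ⊙ sₐ ⊙ id ≋ fₘ ⊙ id
    p₆ = ⟨ move (p6 i) ⟩
    p₇ : q₂ ⊙ b₃ ⊙ b ⊙ c ⊙ fₐ ⊙ id ≋ q₂ ⊙ b₂ ⊙ c ⊙ fₐ ⊙ id
    p₇ = ⟨ move (p7 i k) ⟩

    ih₁ : sₐ ⊙ c₁ ≋ fₐ ⊙ c₁ ⊙ b₁ ⊙ b₁^E′
    ih₁ = ⟨ ih k₁ ⟩
    ih₂ : sₐ ⊙ c₂ ≋ fₐ ⊙ c₂ ⊙ b₂^E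
    ih₂ = ⟨ ih k₂ ⟩
    ih₃ : sₐ ⊙ c₃ ≋ fₐ ⊙ c₃ ⊙ b₃^E
    ih₃ = ⟨ ih k₃ ⟩
    ih₄ : sₐ ⊙ c₄ ≋ fₐ ⊙ c₄ ⊙ b₄ ⊙ b₄^E′
    ih₄ = ⟨ ih k₄ ⟩

    p₇-round : (q₂ ⊙ c ⊙ fₐ) ⊙ b₂ ≋ (q₂ ⊙ c ⊙ fₐ) ⊙ (b₃ ⊙ b)
    p₇-round = by (≋-sym p₇)

    p₇-rounds : (q₂ ⊙ c ⊙ fₐ) ⊙ b₂^E ≋ (q₂ ⊙ c ⊙ fₐ) ⊙ (b₃^E ⊙ b^E)
    p₇-rounds = ⟨ catalysed-^-∙ (≈⟦⟧ p₇-round) E ⟩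

    cycle : q₂ ⊙ c₂ ⊙ sₐ ⊙ c ≋ q₃ ⊙ c₃ ⊙ sₐ ⊙ c ⊙ b^E
    cycle = begin
      q₂ ⊙ c₂ ⊙ sₐ ⊙ c                ≈⟨ by ih₂ ⟩
      q₂ ⊙ c₂ ⊙ fₐ ⊙ b₂^E ⊙ c          ≈⟨ by p₇-rounds ⟩
      q₂ ⊙ c₂ ⊙ fₐ ⊙ b₃^E ⊙ b^E ⊙ c    ≈⟨ by p₃ ⟨
      q₃ ⊙ c₃ ⊙ fₐ ⊙ b₃^E ⊙ b^E ⊙ c    ≈⟨ by ih₃ ⟨
      q₃ ⊙ c₃ ⊙ sₐ ⊙ c ⊙ b^E          ∎

    loop-round : (q₃ ⊙ c₃ ⊙ sₐ ⊙ c) ⊙ b₁ ≋ (q₃ ⊙ c₃ ⊙ sₐ ⊙ c) ⊙ (b₄ ⊙ b^E)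
    loop-round = begin
      (q₃ ⊙ c₃ ⊙ sₐ ⊙ c) ⊙ b₁          ≈⟨ by p₄ ⟩
      q₂ ⊙ c₂ ⊙ sₐ ⊙ c ⊙ b₄            ≈⟨ by cycle ⟩
      (q₃ ⊙ c₃ ⊙ sₐ ⊙ c) ⊙ (b₄ ⊙ b^E)  ∎

    loop : (q₃ ⊙ c₃ ⊙ sₐ ⊙ c) ⊙ b₁^E′ ≋ (q₃ ⊙ c₃ ⊙ sₐ ⊙ c) ⊙ (b₄^E′ ⊙ b^EE′)
    loop = ⟨ catalysed-^-∙ (≈⟦⟧ loop-round) E′ ⟩

    run : sₘ ⊙ c ≋ fₘ ⊙ c ⊙ b^E ⊙ b^EE′
    run = begin
      sₘ ⊙ c                                       ≈⟨ by p₁ ⟨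
      q₁ ⊙ c₁ ⊙ sₐ ⊙ c                             ≈⟨ by ih₁ ⟩
      q₁ ⊙ fₐ ⊙ c₁ ⊙ b₁ ⊙ b₁^E′ ⊙ c                ≈⟨ by p₂ ⟨
      q₂ ⊙ c₂ ⊙ sₐ ⊙ c ⊙ b₁^E′                     ≈⟨ by cycle ⟩
      q₃ ⊙ c₃ ⊙ sₐ ⊙ c ⊙ b^E ⊙ b₁^E′               ≈⟨ by loop ⟩
      q₃ ⊙ c₃ ⊙ sₐ ⊙ c ⊙ b^E ⊙ b₄^E′ ⊙ b^EE′       ≈⟨ by p₅ ⟨
      q₄ ⊙ b₄ ⊙ c₄ ⊙ fₐ ⊙ c ⊙ b^E ⊙ b₄^E′ ⊙ b^EE′  ≈⟨ by ih₄ ⟨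
      q₄ ⊙ c₄ ⊙ sₐ ⊙ c ⊙ b^E ⊙ b^EE′               ≈⟨ by p₆ ⟩
      fₘ ⊙ c ⊙ b^E ⊙ b^EE′                          ∎

    -- (b^E)^E unfolds to b^E · (b^E)^E′.
    counter-step : S m · C k m ~ F m · (C k m · (B k m ^ E) ^ E)
    counter-step = ≈⟦⟧ run

  counter-suc : ∀ i → CounterAt (inject₁ i) → CounterAt (suc i)
  counter-suc i ih k = begin
    S m · C k m                   ≈⟨ Step.counter-step i k E′ ih′ ⟩
    F m · (C k m · (b ^ E) ^ E)   ≈⟨ ~-congˡ (F m) (~-congˡ (C k m) (^-*-assoc b E E)) ⟩
    F m · (C k m · b ^ (E * E))   ≡⟨ cong (λ j → F m · (C k m · b ^ j)) E*E≡e ⟩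
    F m · (C k m · b ^ e (toℕ m)) ∎
    where
    open SetoidReasoning (CommutativeMonoid.setoid quotient)
    a m : Fin (suc n)
    a = inject₁ i
    m = suc i
    b : Monomial n
    b = B k m
    E′ E : ℕ
    E′ = pred (e (toℕ i))
    E = suc E′
    E≡e : E ≡ e (toℕ a)
    E≡e = ≡.trans (suc-pred-e (toℕ i)) (cong e (≡.sym (toℕ-inject₁ i)))
    E*E≡e : E * E ≡ e (toℕ m)
    E*E≡e = ≡.trans (cong₂ _*_ (suc-pred-e (toℕ i)) (suc-pred-e (toℕ i))) (≡.sym (e-suc (toℕ i)))
    ih′ : ∀ k′ → S a · C k′ a ~ F a · (C k′ a · B k′ a ^ E)
    ih′ k′ = subst (λ j → S a · C k′ a ~ F a · (C k′ a · B k′ a ^ j)) (≡.sym E≡e) (ih k′)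

  counter : ∀ i → CounterAt i
  counter = <-weakInduction CounterAt counter-zero counter-suc

  counter-n : ∀ k → S N · C k N ~ F N · (C k N · B k N ^ e n)
  counter-n k = subst (λ j → S N · C k N ~ F N · (C k N · B k N ^ e j)) (toℕ-fromℕ n) (counter N k)

module Reduction (n m₁ m₂ : ℕ) (m₁+m₂≡e : m₁ + m₂ ≡ e n) where

  open Gens n
  open Vars n
  open Moves n
  open Powers quotient using (catalysed-^; catalysed-^-∙; ^-distribˡ-+-∙)

  ^e-split : ∀ t → t ^ e n ~ t ^ m₁ · t ^ m₂
  ^e-split t = ~-trans (≈⇒~ (cong (t ^_) (≡.sym m₁+m₂≡e))) (^-distribˡ-+-∙ t m₁ m₂)

  open RewritingModuloAC quotient
    ( unitM vℓ ∷ unitM vc ∷ unitM vc̄ ∷ unitM vb ∷ unitM vb̄ ∷ unitM vs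
    ∷ unitM (bV false k₄ N) ∷ unitM (cV false k₄ N) ∷ unitM (fV false N) ∷ unitM (sV false N)
    ∷ unitM (bV true k₄ N) ∷ unitM (cV true k₄ N) ∷ unitM (fV true N) ∷ unitM (sV true N)
    ∷ unitM vc̄ ^ m₁ ∷ unitM vc ^ m₂ ∷ unitM vb̄ ^ m₁ ∷ unitM vb ^ m₂
    ∷ unitM (bV false k₄ N) ^ m₁ ∷ unitM (bV false k₄ N) ^ m₂ ∷ unitM (bV false k₄ N) ^ e n
    ∷ unitM (bV true k₄ N) ^ m₁ ∷ unitM (bV true k₄ N) ^ m₂ ∷ unitM (bV true k₄ N) ^ e n ∷ [])
  open SetoidReasoning ≋-setoid

  ℓ c c̄ b b̄ s b₄ c₄ fₙ sₙ b̄₄ c̄₄ f̄ₙ s̄ₙ : Expr 24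
  c̄^m₁ c^m₂ b̄^m₁ b^m₂ b₄^m₁ b₄^m₂ b₄^e b̄₄^m₁ b̄₄^m₂ b̄₄^e : Expr 24
  ℓ = var (# 0); c = var (# 1); c̄ = var (# 2); b = var (# 3); b̄ = var (# 4); s = var (# 5)
  b₄ = var (# 6);  c₄ = var (# 7);  fₙ = var (# 8);  sₙ = var (# 9)
  b̄₄ = var (# 10); c̄₄ = var (# 11); f̄ₙ = var (# 12); s̄ₙ = var (# 13)
  c̄^m₁ = var (# 14); c^m₂ = var (# 15); b̄^m₁ = var (# 16); b^m₂ = var (# 17)
  b₄^m₁ = var (# 18); b₄^m₂ = var (# 19); b₄^e = var (# 20)
  b̄₄^m₁ = var (# 21); b̄₄^m₂ = var (# 22); b̄₄^e = var (# 23)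

  g₁ : b₄ ⊙ ℓ ⊙ b ⊙ id ≋ ℓ ⊙ c ⊙ id
  g₁ = ⟨ rule-unit g1 ⟩
  g₂ : b₄ ⊙ ℓ ⊙ b̄ ⊙ id ≋ ℓ ⊙ c̄ ⊙ id
  g₂ = ⟨ rule-unit g2 ⟩
  g₃ : c₄ ⊙ fₙ ⊙ id ≋ ℓ ⊙ id
  g₃ = ⟨ rule-unit g3 ⟩
  g₄ : c̄₄ ⊙ f̄ₙ ⊙ id ≋ c₄ ⊙ sₙ ⊙ id
  g₄ = ⟨ rule-unit g4 ⟩
  g₅ : b̄₄ ⊙ c₄ ⊙ sₙ ⊙ id ≋ c₄ ⊙ sₙ ⊙ b ⊙ id
  g₅ = ⟨ rule-unit g5 ⟩
  g₆ : b̄₄ ⊙ c₄ ⊙ sₙ ⊙ id ≋ c₄ ⊙ sₙ ⊙ b̄ ⊙ id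
  g₆ = ⟨ rule-unit g6 ⟩
  g₇ : c̄₄ ⊙ s̄ₙ ⊙ id ≋ s ⊙ id
  g₇ = ⟨ rule-unit g7 ⟩

  counter : sₙ ⊙ c₄ ≋ fₙ ⊙ c₄ ⊙ b₄^e
  counter = ⟨ Counter.counter-n n false k₄ ⟩
  counter̄ : s̄ₙ ⊙ c̄₄ ≋ f̄ₙ ⊙ c̄₄ ⊙ b̄₄^e
  counter̄ = ⟨ Counter.counter-n n true k₄ ⟩

  b₄^e-split : b₄^e ≋ b₄^m₁ ⊙ b₄^m₂
  b₄^e-split = ⟨ ^e-split _ ⟩
  b̄₄^e-split : b̄₄^e ≋ b̄₄^m₁ ⊙ b̄₄^m₂
  b̄₄^e-split = ⟨ ^e-split _ ⟩

  g₁-round : ℓ ⊙ c ≋ ℓ ⊙ (b₄ ⊙ b)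
  g₁-round = by (≋-sym g₁)
  g₁-rounds : ℓ ⊙ c^m₂ ≋ ℓ ⊙ (b₄^m₂ ⊙ b^m₂)
  g₁-rounds = ⟨ catalysed-^-∙ (≈⟦⟧ g₁-round) m₂ ⟩

  g₂-round : ℓ ⊙ c̄ ≋ ℓ ⊙ (b₄ ⊙ b̄)
  g₂-round = by (≋-sym g₂)
  g₂-rounds : ℓ ⊙ c̄^m₁ ≋ ℓ ⊙ (b₄^m₁ ⊙ b̄^m₁)
  g₂-rounds = ⟨ catalysed-^-∙ (≈⟦⟧ g₂-round) m₁ ⟩

  g₅-round : (sₙ ⊙ c₄) ⊙ b ≋ (sₙ ⊙ c₄) ⊙ b̄₄
  g₅-round = by (≋-sym g₅)
  g₅-rounds : (sₙ ⊙ c₄) ⊙ b^m₂ ≋ (sₙ ⊙ c₄) ⊙ b̄₄^m₂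
  g₅-rounds = ⟨ catalysed-^ (≈⟦⟧ g₅-round) m₂ ⟩

  g₆-round : (sₙ ⊙ c₄) ⊙ b̄ ≋ (sₙ ⊙ c₄) ⊙ b̄₄
  g₆-round = by (≋-sym g₆)
  g₆-rounds : (sₙ ⊙ c₄) ⊙ b̄^m₁ ≋ (sₙ ⊙ c₄) ⊙ b̄₄^m₁
  g₆-rounds = ⟨ catalysed-^ (≈⟦⟧ g₆-round) m₁ ⟩

  reduction : ℓ ⊙ c̄^m₁ ⊙ c^m₂ ≋ s ⊙ id
  reduction = begin
    ℓ ⊙ c̄^m₁ ⊙ c^m₂                       ≈⟨ by g₁-rounds ⟩
    ℓ ⊙ c̄^m₁ ⊙ b₄^m₂ ⊙ b^m₂               ≈⟨ by g₂-rounds ⟩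
    ℓ ⊙ b₄^m₁ ⊙ b̄^m₁ ⊙ b₄^m₂ ⊙ b^m₂       ≈⟨ by b₄^e-split ⟨
    ℓ ⊙ b₄^e ⊙ b̄^m₁ ⊙ b^m₂                ≈⟨ by g₃ ⟨
    c₄ ⊙ fₙ ⊙ b₄^e ⊙ b̄^m₁ ⊙ b^m₂          ≈⟨ by counter ⟨
    sₙ ⊙ c₄ ⊙ b̄^m₁ ⊙ b^m₂                 ≈⟨ by g₅-rounds ⟩
    sₙ ⊙ c₄ ⊙ b̄^m₁ ⊙ b̄₄^m₂                ≈⟨ by g₆-rounds ⟩
    sₙ ⊙ c₄ ⊙ b̄₄^m₁ ⊙ b̄₄^m₂               ≈⟨ by b̄₄^e-split ⟨
    sₙ ⊙ c₄ ⊙ b̄₄^e                        ≈⟨ by g₄ ⟨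
    c̄₄ ⊙ f̄ₙ ⊙ b̄₄^e                        ≈⟨ by counter̄ ⟨
    s̄ₙ ⊙ c̄₄                               ≈⟨ by g₇ ⟩
    s ⊙ id                                ∎

  αC≡ : αC m₁ m₂ ≡ unitM vℓ · (unitM vc̄ ^ m₁ · unitM vc ^ m₂)
  αC≡ = cong (unitM vℓ ·_)
    (≡.trans (mono-++ {n} (List.replicate m₁ vc̄) (List.replicate m₂ vc))
             (cong₂ _·_ (mono-replicate {n} m₁ vc̄) (mono-replicate {n} m₂ vc)))

  α~s : αC m₁ m₂ ~ mono (vs ∷ [])
  α~s = ~-trans (≈⇒~ αC≡) (≈⟦⟧ reduction)

lemma4p4 : (n : ℕ) (O : MonomialOrder n) →
    (∀ m₁ m₂ → m₁ + m₂ ≡ e n →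
      MonomialOrder._≺_ O (mono (Vars.vs n ∷ [])) (Gens.αC n m₁ m₂)) →
    ∀ m₁ m₂ → m₁ + m₂ ≡ e n → MonomialOrder.InS O (Gens.αC n m₁ m₂ ∷ [])
lemma4p4 n O s≺α m₁ m₂ m₁+m₂≡e α-residual =
  ≺⇒⋢ O (s≺α m₁ m₂ m₁+m₂≡e)
    (α-residual (mono (Vars.vs n ∷ []) ∷ []) (~⇒InIdeal (Reduction.α~s n m₁ m₂ m₁+m₂≡e)))
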